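{- Every permutation $\pi$ of $\{1,\dots,n\}$ can be transformed into the identity permutation by $n-\operatorname{lis}(\pi)$ monotone block moves.
   Context: A block move $(i,j,k)$ with $1\le i\le j<k\le n$ exchanges the adjacent blocks $\pi_i\dots\pi_j$ and $\pi_{j+1}\dots\pi_k$; it is monotone if $\pi_q>\pi_r$ for all $i\le q\le j<r\le k$. $\operatorname{lis}(\pi)$ is the length of a longest increasing subsequence of $\pi$. -}

module Defs where

open import Data.Nat using (ℕ; zero; suc; _<_; _≤_; _>_; _∸_)
open import Data.List using (List; []; _∷_; _++_; length; applyUpTo)
open import Data.List.Membership.Propositional using (_∈_)
open import Data.List.Relation.Binary.Permutation.Propositional using (_↭_)
open import Data.List.Relation.Binary.Sublist.Propositional using (_⊆_)
open import Data.List.Relation.Unary.Linked using (Linked)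
open import Data.Product using (Σ; ∃; _×_; _,_)
open import Relation.Binary.PropositionalEquality using (_≡_)

idPerm : ℕ → List ℕ
idPerm n = applyUpTo suc n

-- π is a permutation of {1,…,n} (in one-line notation).
IsPerm : ℕ → List ℕ → Set
IsPerm n π = π ↭ idPerm n

NonEmpty : List ℕ → Set
NonEmpty xs = 0 < length xs

-- A monotone block move turning π into σ: π = A ++ B ++ C ++ D with the
-- adjacent blocks B = π_i…π_j and C = π_{j+1}…π_k nonempty
-- (i.e. 1 ≤ i ≤ j < k ≤ n, with i = |A|+1, j = |A|+|B|, k = j+|C|),
-- every entry of B larger than every entry of C, and σ = A ++ C ++ B ++ D.
MonotoneBlockMove : List ℕ → List ℕ → Set
MonotoneBlockMove π σ =
  Σ (List ℕ) λ A → Σ (List ℕ) λ B → Σ (List ℕ) λ C → Σ (List ℕ) λ D →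
    NonEmpty B × NonEmpty C ×
    (∀ {b c} → b ∈ B → c ∈ C → b > c) ×
    (π ≡ A ++ B ++ C ++ D) ×
    (σ ≡ A ++ C ++ B ++ D)

data MonotoneSteps : ℕ → List ℕ → List ℕ → Set where
  done : ∀ {π} → MonotoneSteps zero π π
  step : ∀ {m π ρ σ} → MonotoneBlockMove π ρ → MonotoneSteps m ρ σ →
         MonotoneSteps (suc m) π σ

IncSubseq : List ℕ → List ℕ → Set
IncSubseq s π = (s ⊆ π) × Linked _<_ s

IsLis : List ℕ → ℕ → Set
IsLis π l =
  (∃ λ s → IncSubseq s π × length s ≡ l) ×
  (∀ s → IncSubseq s π → length s ≤ l)

-- Take a longest increasing subsequence s of π and the first entry x of π that s skips, so that every
-- entry in front of x belongs to s. If one of them exceeds x, or (reading π backwards with the order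
-- reversed) one of the entries of s after x is below x, then x, or an entry found by walking to the
-- left, can be slid over a block of larger entries to a slot where it extends s; otherwise x itself
-- extends s, contradicting maximality. Moving a single entry raises lis by at most one, so each move
-- raises lis by exactly one and n - lis(π) moves reach the sorted permutation.
module Submission where

open import Defs
open import Data.Empty using (⊥-elim)
open import Data.List using (List; []; _∷_; _++_; [_]; length; reverse)
open import Data.List.Properties
  using (++-assoc; length-++-sucʳ; unfold-reverse; reverse-++; reverse-involutive; length-reverse; length-applyUpTo)
open import Data.List.Membership.Propositional using (_∈_)
open import Data.List.Relation.Unary.All as All using (All; []; _∷_)
import Data.List.Relation.Unary.All.Properties as Allₚ
open import Data.List.Relation.Unary.Any using (Any; here; there)
import Data.List.Relation.Unary.Any.Properties as Anyₚ
open import Data.List.Relation.Unary.AllPairs as AllPairs using (AllPairs; []; _∷_)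
import Data.List.Relation.Unary.AllPairs.Properties as AllPairsₚ
open import Data.List.Relation.Unary.Linked as Linked using (Linked)
open import Data.List.Relation.Unary.Linked.Properties as Linkedₚ using (Linked⇒AllPairs; AllPairs⇒Linked)
open import Data.List.Relation.Unary.Unique.Propositional using (Unique)
import Data.List.Relation.Unary.Sorted.TotalOrder.Properties as Sortedₚ
open import Data.List.Relation.Binary.Equality.Propositional using (≋⇒≡)
open import Data.List.Relation.Binary.Sublist.Propositional using (_⊆_; []; _∷_; _∷ʳ_; ⊆-refl; ⊆-trans)
open import Data.List.Relation.Binary.Sublist.Propositional.Properties
  using (++⁺; ++⁺ʳ; reverse⁺; length-mono-≤; to-≋; All-resp-⊆; Any-resp-⊆)
open import Data.List.Relation.Binary.Permutation.Propositional using (_↭_; ↭-sym; ↭-trans; ↭⇒↭ₛ)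
open import Data.List.Relation.Binary.Permutation.Propositional.Properties
  using (++⁺ˡ; shifts; ↭-reverse; All-resp-↭; ↭-length)
import Data.List.Relation.Binary.Permutation.Setoid.Properties as Permₛ
open import Data.Nat using (ℕ; zero; suc; _<_; _≤_; _>_; _∸_; z≤n; s≤s; pred)
open import Data.Nat.Properties
  using (<-trans; <-cmp; <⇒≢; <⇒≤; ≤-refl; ≤-trans; n≤1+n; n<1+n; 0≢1+n; ≤-antisym; ≤-totalOrder; 1+n≰n;
         m∸n≡0⇒m≤n; m∸n≢0⇒n<m; pred[m∸n]≡m∸[1+n])
open import Data.Nat.Induction using (<-wellFounded)
open import Data.Product using (Σ-syntax; _×_; _,_)
open import Data.Sum using (_⊎_; inj₁; inj₂)
open import Function using (flip; _∘_)
open import Induction.WellFounded using (Acc; acc)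
open import Level using (0ℓ)
open import Relation.Binary.Core using (Rel)
open import Relation.Binary.Definitions using (Transitive; Trichotomous; Asymmetric; tri<; tri≈; tri>)
open import Relation.Binary.Consequences using (tri⇒asym)
import Relation.Binary.Construct.Flip.EqAndOrd as Flip
open import Relation.Binary.PropositionalEquality
  using (_≡_; _≢_; refl; sym; trans; cong; subst; ≢-sym; setoid; module ≡-Reasoning)

private
  variable
    X : Set
    y : X
    xs ys zs : List X

All-reverse⁺ : ∀ {P : X → Set} → All P xs → All P (reverse xs)
All-reverse⁺ {xs = xs} = All-resp-↭ (↭-sym (↭-reverse xs))

All-reverse⁻ : ∀ {P : X → Set} → All P (reverse xs) → All P xs
All-reverse⁻ {xs = xs} = All-resp-↭ (↭-reverse xs)

All-insert : ∀ {P : X → Set} xs → All P (xs ++ ys) → P y → All P (xs ++ y ∷ ys)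
All-insert xs p py with Allₚ.++⁻ xs p
... | pxs , pys = Allₚ.++⁺ pxs (py ∷ pys)

module _ {R : Rel X 0ℓ} where

  AllPairs-resp-⊆ : xs ⊆ ys → AllPairs R ys → AllPairs R xs
  AllPairs-resp-⊆ []         []       = []
  AllPairs-resp-⊆ (_ ∷ʳ p)   (_ ∷ rs) = AllPairs-resp-⊆ p rs
  AllPairs-resp-⊆ (refl ∷ p) (r ∷ rs) = All-resp-⊆ p r ∷ AllPairs-resp-⊆ p rs

  AllPairs-before : ∀ xs → AllPairs R (xs ++ y ∷ ys) → All (λ z → R z y) xs
  AllPairs-before []       _        = []
  AllPairs-before (x ∷ xs) (r ∷ rs) = All.head (Allₚ.++⁻ʳ xs r) ∷ AllPairs-before xs rs

  AllPairs-after : ∀ xs → AllPairs R (xs ++ y ∷ ys) → All (R y) ys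
  AllPairs-after []       (r ∷ _)  = r
  AllPairs-after (x ∷ xs) (_ ∷ rs) = AllPairs-after xs rs

  AllPairs-insert : ∀ xs → AllPairs R (xs ++ ys) → All (λ z → R z y) xs → All (R y) ys →
                    AllPairs R (xs ++ y ∷ ys)
  AllPairs-insert []       rs       []       ry = ry ∷ rs
  AllPairs-insert (x ∷ xs) (r ∷ rs) (rx ∷ p) ry = All-insert xs r rx ∷ AllPairs-insert xs rs p ry

  AllPairs-reverse : AllPairs R xs → AllPairs (flip R) (reverse xs)
  AllPairs-reverse []                   = []
  AllPairs-reverse {xs = x ∷ xs} (r ∷ rs) =
    subst (AllPairs (flip R)) (sym (unfold-reverse x xs))
      (AllPairsₚ.++⁺ (AllPairs-reverse rs) ([] ∷ []) (All.map (_∷ []) (All-reverse⁺ r)))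

Unique-reverse : Unique xs → Unique (reverse xs)
Unique-reverse = AllPairs.map ≢-sym ∘ AllPairs-reverse

reverse-++-∷ : ∀ (xs : List X) y ys → reverse (xs ++ y ∷ ys) ≡ reverse ys ++ y ∷ reverse xs
reverse-++-∷ xs y ys = begin
  reverse (xs ++ y ∷ ys)              ≡⟨ reverse-++ xs (y ∷ ys) ⟩
  reverse (y ∷ ys) ++ reverse xs      ≡⟨ cong (_++ reverse xs) (unfold-reverse y ys) ⟩
  (reverse ys ++ [ y ]) ++ reverse xs ≡⟨ ++-assoc (reverse ys) [ y ] (reverse xs) ⟩
  reverse ys ++ y ∷ reverse xs        ∎
  where open ≡-Reasoning

length-<-++-∷ : ∀ (xs : List X) → length xs < length (xs ++ y ∷ ys)
length-<-++-∷ []       = s≤s z≤n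
length-<-++-∷ (x ∷ xs) = s≤s (length-<-++-∷ xs)

⊆-skip : ∀ (xs : List X) → xs ++ ys ⊆ xs ++ y ∷ ys
⊆-skip xs = ++⁺ (⊆-refl {x = xs}) (_ ∷ʳ ⊆-refl)

⊆-split : ∀ xs → zs ⊆ xs ++ ys →
          Σ[ zs₁ ∈ List X ] Σ[ zs₂ ∈ List X ] (zs ≡ zs₁ ++ zs₂ × zs₁ ⊆ xs × zs₂ ⊆ ys)
⊆-split []       p          = [] , _ , refl , [] , p
⊆-split (x ∷ xs) (.x ∷ʳ p)  with ⊆-split xs p
... | zs₁ , zs₂ , refl , p₁ , p₂ = zs₁ , zs₂ , refl , x ∷ʳ p₁ , p₂
⊆-split (x ∷ xs) (refl ∷ p) with ⊆-split xs p
... | zs₁ , zs₂ , refl , p₁ , p₂ = x ∷ zs₁ , zs₂ , refl , refl ∷ p₁ , p₂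

⊆-delete : ∀ xs → zs ⊆ xs ++ y ∷ ys →
           Σ[ zs′ ∈ List X ] (zs′ ⊆ zs × zs′ ⊆ xs ++ ys × length zs ≤ suc (length zs′))
⊆-delete []       (_ ∷ʳ p)   = _ , ⊆-refl , p , n≤1+n _
⊆-delete []       (refl ∷ p) = _ , _ ∷ʳ ⊆-refl , p , ≤-refl
⊆-delete (x ∷ xs) (.x ∷ʳ p)  with ⊆-delete xs p
... | zs′ , q , r , le = zs′ , q , x ∷ʳ r , le
⊆-delete (x ∷ xs) (refl ∷ p) with ⊆-delete xs p
... | zs′ , q , r , le = x ∷ zs′ , refl ∷ q , refl ∷ r , s≤s le

firstSkipped : zs ⊆ xs → length zs < length xs →
               Σ[ P ∈ List X ] Σ[ x ∈ X ] Σ[ R ∈ List X ] Σ[ zs₂ ∈ List X ]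
                 (xs ≡ P ++ x ∷ R × zs ≡ P ++ zs₂ × zs₂ ⊆ R)
firstSkipped (x ∷ʳ p)   _ = [] , x , _ , _ , refl , refl , p
firstSkipped (refl ∷ p) (s≤s lt) with firstSkipped p lt
... | P , x , R , zs₂ , refl , refl , p₂ = _ ∷ P , x , R , zs₂ , refl , refl , p₂

⊆-length-≥ : zs ⊆ xs → length xs ≤ length zs → zs ≡ xs
⊆-length-≥ p le = ≋⇒≡ (to-≋ (≤-antisym (length-mono-≤ p) le) p)

Any⇒NonEmpty : ∀ {P : ℕ → Set} {xs} → Any P xs → NonEmpty xs
Any⇒NonEmpty (here _)  = s≤s z≤n
Any⇒NonEmpty (there _) = s≤s z≤n

++-∷-reassoc : ∀ (xs : List X) y ys zs → (xs ++ y ∷ ys) ++ zs ≡ (xs ++ [ y ]) ++ ys ++ zs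
++-∷-reassoc xs y ys zs = trans (++-assoc xs (y ∷ ys) zs) (sym (++-assoc xs [ y ] (ys ++ zs)))

-- Sliding an entry to the left over a block of larger entries, for any strict total order

module Insertion {_≺_ : Rel ℕ 0ℓ} (≺-trans : Transitive _≺_) (compare : Trichotomous _≡_ _≺_) where

  ≺-asym : Asymmetric _≺_
  ≺-asym = tri⇒asym compare

  above-or-below : ∀ {x} xs → All (_≢ x) xs → Any (x ≺_) xs ⊎ All (_≺ x) xs
  above-or-below []       []            = inj₂ []
  above-or-below {x} (y ∷ ys) (y≢x ∷ ys≢x) with compare x y | above-or-below ys ys≢x
  ... | tri< x≺y _ _ | _           = inj₁ (here x≺y)
  ... | tri≈ _ x≡y _ | _           = ⊥-elim (y≢x (sym x≡y))
  ... | tri> _ _ y≺x | inj₁ x≺ys   = inj₁ (there x≺ys)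
  ... | tri> _ _ y≺x | inj₂ ys≺x   = inj₂ (y≺x ∷ ys≺x)

  lastBelow : ∀ {x} P → All (_≢ x) P →
              All (x ≺_) P ⊎
              Σ[ P₁ ∈ List ℕ ] Σ[ y ∈ ℕ ] Σ[ P₂ ∈ List ℕ ] (P ≡ P₁ ++ y ∷ P₂ × y ≺ x × All (x ≺_) P₂)
  lastBelow []      []          = inj₁ []
  lastBelow (p ∷ P) (p≢x ∷ P≢x) with lastBelow P P≢x
  ... | inj₂ (P₁ , y , P₂ , refl , y≺x , x≺P₂) = inj₂ (p ∷ P₁ , y , P₂ , refl , y≺x , x≺P₂)
  ... | inj₁ x≺P with compare _ p
  ...   | tri< x≺p _ _ = inj₁ (x≺p ∷ x≺P)
  ...   | tri≈ _ x≡p _ = ⊥-elim (p≢x (sym x≡p))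
  ...   | tri> _ _ p≺x = inj₂ ([] , p , P , refl , p≺x , x≺P)

  above-after : ∀ {x} s₁ {s₂} → Any (x ≺_) s₁ → AllPairs _≺_ (s₁ ++ s₂) → All (x ≺_) s₂
  above-after (y ∷ s₁) (here x≺y) (y≺ ∷ _)  = All.map (≺-trans x≺y) (Allₚ.++⁻ʳ s₁ y≺)
  above-after (y ∷ s₁) (there x≺s₁) (_ ∷ s↗) = above-after s₁ x≺s₁ s↗

  above-in-suffix : ∀ {x} a {v} → Any (x ≺_) (a ++ v) → All (_≺ x) a → Any (x ≺_) v
  above-in-suffix []      x≺v          []          = x≺v
  above-in-suffix (_ ∷ a) (here x≺z)   (z≺x ∷ _)   = ⊥-elim (≺-asym x≺z z≺x)
  above-in-suffix (_ ∷ a) (there x≺av) (_ ∷ a≺x)   = above-in-suffix a x≺av a≺x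

  record LeftInsertion (π : List ℕ) (l : ℕ) : Set where
    constructor leftInsertion
    field
      A B D      : List ℕ
      x          : ℕ
      π≡         : π ≡ A ++ B ++ x ∷ D
      B-nonEmpty : NonEmpty B
      x≺B        : All (x ≺_) B
      t          : List ℕ
      t⊆         : t ⊆ A ++ x ∷ B ++ D
      t↗         : AllPairs _≺_ t
      t-length   : length t ≡ suc l

  insertBefore : ∀ {π s} A {B D x} a {b} → π ≡ A ++ B ++ x ∷ D → s ≡ a ++ b → AllPairs _≺_ s →
                 a ⊆ A → b ⊆ B ++ D → All (_≺ x) a → All (x ≺_) b → NonEmpty B → All (x ≺_) B →
                 LeftInsertion π (length s)
  insertBefore A a π≡ refl s↗ a⊆ b⊆ a≺x x≺b B-nonEmpty x≺B =
    leftInsertion A _ _ _ π≡ B-nonEmpty x≺B (a ++ _ ∷ _) (++⁺ a⊆ (refl ∷ b⊆))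
      (AllPairs-insert a s↗ a≺x x≺b) (length-++-sucʳ a _ _)

  insertAfter : ∀ P₁ y P₂ {x R} a v {s₁ s₂} → s₁ ≡ a ++ v → AllPairs _≺_ (s₁ ++ s₂) →
                a ⊆ P₁ ++ [ y ] → v ⊆ P₂ → s₂ ⊆ R → All (_≺ x) a → All (x ≺_) P₂ → Any (x ≺_) s₁ →
                LeftInsertion ((P₁ ++ y ∷ P₂) ++ x ∷ R) (length (s₁ ++ s₂))
  insertAfter P₁ y P₂ a v refl s↗ a⊆ v⊆ s₂⊆ a≺x x≺P₂ x≺s₁ =
    insertBefore (P₁ ++ [ y ]) a (++-∷-reassoc P₁ y P₂ _) (++-assoc a v _) s↗ a⊆ (++⁺ v⊆ s₂⊆) a≺x
      (Allₚ.++⁺ (All-resp-⊆ v⊆ x≺P₂) (above-after (a ++ v) x≺s₁ s↗))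
      (Any⇒NonEmpty (Any-resp-⊆ v⊆ (above-in-suffix a x≺s₁ a≺x))) x≺P₂

  -- y is the last entry of P below x. Unless an entry of s in front of y lies above y (and then y
  -- takes over the role of x), x can be slid left to just behind y.
  slideLeft : ∀ {π s} P {x R} s₁ {s₂} → Acc _<_ (length P) → π ≡ P ++ x ∷ R → Unique π →
              s ≡ s₁ ++ s₂ → AllPairs _≺_ s → s₁ ⊆ P → s₂ ⊆ R → Any (x ≺_) s₁ →
              LeftInsertion π (length s)
  slideLeft P s₁ (acc rec) refl π! refl s↗ s₁⊆ s₂⊆ x≺s₁ with lastBelow P (AllPairs-before P π!)
  ... | inj₁ x≺P =
    insertBefore [] [] refl refl s↗ [] (++⁺ s₁⊆ s₂⊆) []
      (Allₚ.++⁺ (All-resp-⊆ s₁⊆ x≺P) (above-after s₁ x≺s₁ s↗))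
      (Any⇒NonEmpty (Any-resp-⊆ s₁⊆ x≺s₁)) x≺P
  ... | inj₂ (P₁ , y , P₂ , refl , y≺x , x≺P₂) with ⊆-split P₁ s₁⊆
  ...   | u , _ , refl , u⊆ , (refl ∷ v⊆) =
    insertAfter P₁ y P₂ (u ++ [ y ]) _ (sym (++-assoc u [ y ] _)) s↗ (++⁺ u⊆ (refl ∷ [])) v⊆ s₂⊆
      (Allₚ.++⁺ (All.map (λ z≺y → ≺-trans z≺y y≺x) u≺y) (y≺x ∷ [])) x≺P₂ x≺s₁
    where u≺y = AllPairs-before u (subst (AllPairs _≺_) (++-assoc u _ _) s↗)
  ...   | u , v , refl , u⊆ , (.y ∷ʳ v⊆)
        with above-or-below u (All-resp-⊆ u⊆ (AllPairs-before P₁ (subst Unique (++-assoc P₁ _ _) π!)))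
  ...     | inj₁ y≺u =
    slideLeft P₁ u (rec (length-<-++-∷ P₁)) (++-assoc P₁ _ _) π! (++-assoc u v _) s↗ u⊆
      (++⁺ v⊆ (_ ∷ʳ s₂⊆)) y≺u
  ...     | inj₂ u≺y =
    insertAfter P₁ y P₂ u v refl s↗ (++⁺ʳ [ y ] u⊆) v⊆ s₂⊆
      (All.map (λ z≺y → ≺-trans z≺y y≺x) u≺y) x≺P₂ x≺s₁

module Left  = Insertion <-trans <-cmp
-- Right.slideLeft, applied to reverse π, slides an entry of π to the right over smaller entries.
module Right = Insertion (Flip.trans _<_ <-trans) (Flip.compare _<_ <-cmp)

Longest : List ℕ → ℕ → Set
Longest π l = ∀ t → IncSubseq t π → length t ≤ l

SublistUpToOne : List ℕ → List ℕ → Set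
SublistUpToOne σ π = Σ[ U ∈ List ℕ ] Σ[ x ∈ ℕ ] Σ[ V ∈ List ℕ ] (σ ≡ U ++ x ∷ V × U ++ V ⊆ π)

Longest-upToOne : ∀ {σ π l} → SublistUpToOne σ π → Longest π l → Longest σ (suc l)
Longest-upToOne (U , x , V , refl , UV⊆π) longest t (t⊆ , t↗) with ⊆-delete U t⊆
... | t′ , t′⊆t , t′⊆UV , le =
  ≤-trans le (s≤s (longest t′ (⊆-trans t′⊆UV UV⊆π ,
    AllPairs⇒Linked (AllPairs-resp-⊆ t′⊆t (Linked⇒AllPairs <-trans t↗)))))

blockMove-↭ : ∀ {π σ} → MonotoneBlockMove π σ → π ↭ σ
blockMove-↭ (A , B , C , D , _ , _ , _ , refl , refl) = ++⁺ˡ A (shifts B C)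

record Improvement (π : List ℕ) (l : ℕ) : Set where
  constructor improvement
  field
    σ      : List ℕ
    move   : MonotoneBlockMove π σ
    almost : SublistUpToOne σ π
    longer : Σ[ t ∈ List ℕ ] (IncSubseq t σ × length t ≡ suc l)

fromLeft : ∀ {π l} → Left.LeftInsertion π l → Improvement π l
fromLeft (Left.leftInsertion A B D x refl B-nonEmpty x<B t t⊆ t↗ t-length) =
  improvement (A ++ x ∷ B ++ D)
    (A , B , [ x ] , D , B-nonEmpty , s≤s z≤n , B>x , refl , refl)
    (A , x , B ++ D , refl , ++⁺ (⊆-refl {x = A}) (⊆-skip B))
    (t , (t⊆ , AllPairs⇒Linked t↗) , t-length)
  where
  B>x : ∀ {b c} → b ∈ B → c ∈ [ x ] → b > c
  B>x b∈B (here refl) = All.lookup x<B b∈B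

fromRight : ∀ {π l} → Right.LeftInsertion (reverse π) l → Improvement π l
fromRight {π} {l} (Right.leftInsertion A B D x rπ≡ B-nonEmpty x>B t t⊆ t↘ t-length) =
  subst (λ π → Improvement π l) (sym π≡)
    (improvement (rD ++ rB ++ x ∷ rA)
      (rD , [ x ] , rB , rA , s≤s z≤n , subst (0 <_) (sym (length-reverse B)) B-nonEmpty ,
       x>rB , refl , refl)
      (rD ++ rB , x , rA , sym (++-assoc rD rB _) ,
       subst (_⊆ rD ++ x ∷ rB ++ rA) (sym (++-assoc rD rB rA)) (⊆-skip rD))
      (reverse t , (subst (reverse t ⊆_) σ-reverse (reverse⁺ t⊆) , AllPairs⇒Linked (AllPairs-reverse t↘)) ,
       trans (length-reverse t) t-length))
  where
  open ≡-Reasoning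
  rA = reverse A
  rB = reverse B
  rD = reverse D

  π≡ : π ≡ rD ++ x ∷ rB ++ rA
  π≡ = begin
    π                              ≡⟨ reverse-involutive π ⟨
    reverse (reverse π)            ≡⟨ cong reverse rπ≡ ⟩
    reverse (A ++ B ++ x ∷ D)      ≡⟨ cong reverse (++-assoc A B _) ⟨
    reverse ((A ++ B) ++ x ∷ D)    ≡⟨ reverse-++-∷ (A ++ B) x D ⟩
    rD ++ x ∷ reverse (A ++ B)     ≡⟨ cong (λ zs → rD ++ x ∷ zs) (reverse-++ A B) ⟩
    rD ++ x ∷ rB ++ rA             ∎

  σ-reverse : reverse (A ++ x ∷ B ++ D) ≡ rD ++ rB ++ x ∷ rA
  σ-reverse = begin
    reverse (A ++ x ∷ B ++ D)      ≡⟨ reverse-++-∷ A x (B ++ D) ⟩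
    reverse (B ++ D) ++ x ∷ rA     ≡⟨ cong (_++ x ∷ rA) (reverse-++ B D) ⟩
    (rD ++ rB) ++ x ∷ rA           ≡⟨ ++-assoc rD rB _ ⟩
    rD ++ rB ++ x ∷ rA             ∎

  x>rB : ∀ {b c} → b ∈ [ x ] → c ∈ rB → b > c
  x>rB (here refl) c∈rB = All.lookup x>B (Anyₚ.reverse⁻ c∈rB)

improve : ∀ {π s} → Unique π → s ⊆ π → AllPairs _<_ s → Longest π (length s) → length s < length π →
          Improvement π (length s)
improve π! s⊆ s↗ longest s<π with firstSkipped s⊆ s<π
... | P , x , R , s₂ , refl , refl , s₂⊆ with Left.above-or-below P (AllPairs-before P π!)
...   | inj₁ x<P = fromLeft (Left.slideLeft P P (<-wellFounded _) refl π! refl s↗ ⊆-refl s₂⊆ x<P)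
...   | inj₂ P<x with Right.above-or-below (reverse s₂)
                       (All-reverse⁺ (All-resp-⊆ s₂⊆ (All.map ≢-sym (AllPairs-after P π!))))
...     | inj₁ s₂<x =
  subst (Improvement _) (length-reverse (P ++ s₂))
    (fromRight (Right.slideLeft (reverse R) (reverse s₂) (<-wellFounded _) (reverse-++-∷ P x R)
      (Unique-reverse π!) (reverse-++ P s₂) (AllPairs-reverse s↗) (reverse⁺ s₂⊆) ⊆-refl s₂<x))
...     | inj₂ x<s₂ = ⊥-elim (1+n≰n (subst (_≤ length (P ++ s₂)) (length-++-sucʳ P x s₂)
                        (longest (P ++ x ∷ s₂) (++⁺ ⊆-refl (refl ∷ s₂⊆) ,
                          AllPairs⇒Linked (AllPairs-insert P s↗ P<x (All-reverse⁻ x<s₂))))))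

lis-step : ∀ {π l} → Unique π → IsLis π l → l < length π →
           Σ[ σ ∈ List ℕ ] (MonotoneBlockMove π σ × IsLis σ (suc l))
lis-step π! ((s , (s⊆ , s↗) , refl) , longest) s<π
  with improvement σ move almost longer ← improve π! s⊆ (Linked⇒AllPairs <-trans s↗) longest s<π
  = σ , move , longer , Longest-upToOne almost longest

idPerm-↗ : ∀ n → Linked _<_ (idPerm n)
idPerm-↗ n = Linkedₚ.applyUpTo⁺₂ suc n (λ i → n<1+n (suc i))

idPerm-unique : ∀ n → Unique (idPerm n)
idPerm-unique n = AllPairs.map <⇒≢ (Linked⇒AllPairs <-trans (idPerm-↗ n))

IsPerm-length : ∀ {n π} → IsPerm n π → length π ≡ n
IsPerm-length {n} π↭ = trans (↭-length π↭) (length-applyUpTo suc n)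

IsPerm-unique : ∀ {n π} → IsPerm n π → Unique π
IsPerm-unique {n} π↭ = Permₛ.Unique-resp-↭ (setoid ℕ) (↭⇒↭ₛ (↭-sym π↭)) (idPerm-unique n)

increasing-perm≡idPerm : ∀ {n π} → Linked _<_ π → IsPerm n π → π ≡ idPerm n
increasing-perm≡idPerm {n} π↗ π↭ =
  ≋⇒≡ (Sortedₚ.↗↭↗⇒≋ ≤-totalOrder (Linked.map <⇒≤ π↗) (Linked.map <⇒≤ (idPerm-↗ n)) (↭⇒↭ₛ π↭))

m∸n≡1+k⇒n<m : ∀ {m n k} → m ∸ n ≡ suc k → n < m
m∸n≡1+k⇒n<m m∸n≡1+k = m∸n≢0⇒n<m (λ m∸n≡0 → 0≢1+n (trans (sym m∸n≡0) m∸n≡1+k))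

monotoneSort : ∀ k {n π l} → n ∸ l ≡ k → IsPerm n π → IsLis π l → MonotoneSteps k π (idPerm n)
monotoneSort zero {n} {π} n∸l≡0 π↭ ((s , (s⊆ , s↗) , refl) , _) =
  subst (MonotoneSteps 0 π) (increasing-perm≡idPerm (subst (Linked _<_) s≡π s↗) π↭) done
  where
  s≡π : s ≡ π
  s≡π = ⊆-length-≥ s⊆ (subst (_≤ length s) (sym (IsPerm-length π↭)) (m∸n≡0⇒m≤n n∸l≡0))
monotoneSort (suc k) {n} {π} {l} n∸l≡1+k π↭ lis
  with σ , move , lis′ ← lis-step (IsPerm-unique π↭) lis
                           (subst (l <_) (sym (IsPerm-length π↭)) (m∸n≡1+k⇒n<m n∸l≡1+k))
  = step move (monotoneSort k (trans (sym (pred[m∸n]≡m∸[1+n] n l)) (cong pred n∸l≡1+k))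
                 (↭-trans (↭-sym (blockMove-↭ move)) π↭) lis′)

corollary1 : ∀ (n : ℕ) (π : List ℕ) → IsPerm n π → ∀ (l : ℕ) → IsLis π l →
             MonotoneSteps (n ∸ l) π (idPerm n)
corollary1 n π π↭ l = monotoneSort (n ∸ l) refl π↭
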